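{- Let $m\in\{9,10,11\}$ and $n\in\mathbb{N}$ with $n>m$. (i) If $m=9$: $\mathscr{S}_9(n)$ is full if and only if $9n-2$ is not the square of an integer. (ii) If $m=10$: $\mathscr{S}_{10}(n)$ is full if and only if either $n$ is odd and neither $10n-1$ nor $10n-5$ is the square of an integer, or $n$ is even and $10n-4$ is not the square of an integer. (iii) If $m=11$: $\mathscr{S}_{11}(n)$ is full if and only if none of $11n-2$, $11n-6$, $11n-8$ is the square of an integer.
   Context: $\mathbb{N}$ denotes the positive integers. For $m,n\in\mathbb{N}$, $\mathscr{S}_m(n)$ is the set of all $T\in\mathbb{Z}$ for which there exist $x_1,\ldots,x_m\in\mathbb{Z}$ with $x_1+\cdots+x_m=T$ and $x_1^2+\cdots+x_m^2=n$. Let $\mathscr{T}_m(n)=\{T\in\mathbb{Z}: n\equiv T \pmod 2,\ T^2<mn\}$ and $\mathscr{S}_m'(n)=\{T\in\mathscr{S}_m(n): T^2<mn\}$. $\mathscr{S}_m(n)$ is called full if $\mathscr{S}_m'(n)=\mathscr{T}_m(n)$. -}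

module Defs where

open import Data.Nat as ℕ using (ℕ)
open import Data.Integer using (ℤ; +_; _+_; _*_; _-_; _<_)
open import Data.Fin using (Fin)
open import Data.Vec.Functional using (Vector; foldr)
open import Data.Product using (Σ; ∃; _×_)
open import Data.Integer.Divisibility using (_∣_)
open import Relation.Binary.PropositionalEquality using (_≡_)
open import Function.Bundles using (_⇔_)

sumℤ : ∀ {m} → Vector ℤ m → ℤ
sumℤ = foldr _+_ (+ 0)

sumSqℤ : ∀ {m} → Vector ℤ m → ℤ
sumSqℤ x = sumℤ (λ i → x i * x i)

S : ℕ → ℕ → ℤ → Set
S m n T = Σ (Vector ℤ m) λ x → (sumℤ x ≡ T) × (sumSqℤ x ≡ + n)

Tset : ℕ → ℕ → ℤ → Set
Tset m n T = ((+ 2) ∣ (+ n - T)) × (T * T < + (m ℕ.* n))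

S' : ℕ → ℕ → ℤ → Set
S' m n T = S m n T × (T * T < + (m ℕ.* n))

Full : ℕ → ℕ → Set
Full m n = ∀ (T : ℤ) → S' m n T ⇔ Tset m n T

IsSquare : ℤ → Set
IsSquare a = ∃ λ (k : ℤ) → k * k ≡ a

module Submission where

open import Defs
open import Data.Nat using (ℕ; _>_)
open import Data.Nat as ℕ using ()
open import Data.Integer using (+_; _-_)
open import Data.Nat.Divisibility using (_∣_)
open import Data.Product using (_×_)
open import Data.Sum using (_⊎_)
open import Relation.Nullary using (¬_)
open import Function.Bundles using (_⇔_)

open import Data.Nat using (zero; suc; _≤?_)
import Data.Nat.Properties as ℕ
import Data.Nat.Divisibility as ℕ
open import Data.Nat.Divisibility using (divides; ∣⇒≤)
open import Data.Nat.DivMod using (_%_; _/_; m≡m%n+[m/n]*n; m%n<n)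
open import Data.Nat.Induction using (<-rec)
open import Data.Nat.ListAction using (product)
open import Data.Nat.Primality using (Prime; composite; euclidsLemma; prime⇒irreducible; ¬prime[1])
open import Data.Nat.Primality.Factorisation using (PrimeFactorisation; factorise)
open import Data.Nat.Tactic.RingSolver using () renaming (solve-∀ to solveℕ-∀)
open import Data.Integer as ℤ using (ℤ; -[1+_]; _+_; _*_; -_; 0ℤ; 1ℤ; _<_; ∣_∣)
import Data.Integer.Properties as ℤ
import Data.Integer.DivMod as ℤ
import Data.Integer.Divisibility.Signed as ℤ∣
open import Data.Integer.Tactic.RingSolver using (solve-∀)
open import Data.Fin as Fin using (Fin; toℕ; fromℕ<)
import Data.Fin.Properties as Fin
open import Data.Vec.Functional using (Vector; _∷_; []; head; tail)
open import Data.List.Relation.Unary.All as All using (All)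
open import Data.Product using (Σ; ∃; _,_; proj₁; proj₂)
open import Data.Sum using (inj₁; inj₂; reduce; [_,_]′)
open import Data.Empty using (⊥-elim)
open import Function.Base using (_∘_)
open import Function.Bundles using (mk⇔; Equivalence)
open import Relation.Nullary using (Dec; yes; no)
open import Relation.Nullary.Decidable using (toWitness; _→-dec_; _⊎-dec_)
open import Relation.Binary.PropositionalEquality

-- For T ≡ n (mod 2) and T² < m n, translating every coordinate by ⌊T/m⌋ keeps the defect
-- m Σx² − (Σx)² = m n − T² and reduces T to its residue t < m, leaving a required sum of
-- squares N ≡ t (mod 2). If N ≥ t, write N − t = 2s with s = Σ aᵢ² (Lagrange); for m ≥ 9
-- the four pairs uᵢ ± aᵢ (uᵢ ∈ {0, 1}) together with further zeros and ones realise (t, N).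
-- The finitely many pairs with N < t < m leave the defects {2}, {1, 4, 5}, {2, 6, 8} for
-- m = 9, 10, 11, found by enumeration. Conversely the defect Σ_{i<j} (xᵢ − xⱼ)² of a
-- non-constant vector is at least m − 1, so T with T ≡ n and m n − T² = e, 0 < e < m − 1,
-- is never in 𝒮ₘ(n).

Even : ℤ → Set
Even x = + 2 ℤ∣.∣ x

even-double : ∀ x → Even (x + x)
even-double x = ℤ∣.divides x (lem x)
  where lem : ∀ x → x + x ≡ x * + 2
        lem = solve-∀

even-half : ∀ {x} → Even x → ∃ λ v → x ≡ v + v
even-half (ℤ∣.divides v refl) = v , lem v
  where lem : ∀ v → v * + 2 ≡ v + v
        lem = solve-∀

even-or-odd : ∀ x → Even x ⊎ Even (x + 1ℤ)
even-or-odd x with x ℤ.%ℕ 2 | ℤ.n%ℕd<d x 2 | ℤ.a≡a%ℕn+[a/ℕn]*n x 2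
... | 0 | _ | x≡ = inj₁ (ℤ∣.divides (x ℤ./ℕ 2) (trans x≡ (ℤ.+-identityˡ _)))
... | 1 | _ | x≡ = inj₂ (ℤ∣.divides (x ℤ./ℕ 2 + 1ℤ) (trans (cong (_+ 1ℤ) x≡) (lem (x ℤ./ℕ 2))))
  where lem : ∀ q → + 1 + q * + 2 + 1ℤ ≡ (q + 1ℤ) * + 2
        lem = solve-∀
... | suc (suc _) | ℕ.s≤s (ℕ.s≤s ()) | _

¬even-and-odd : ∀ {x} → Even x → ¬ Even (x + 1ℤ)
¬even-and-odd {x} ev od with ℕ.∣1⇒≡1 (ℤ∣.∣⇒∣ᵤ (subst Even (lem x) (ℤ∣.∣m∣n⇒∣m-n od ev)))
  where lem : ∀ x → x + 1ℤ - x ≡ 1ℤ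
        lem = solve-∀
... | ()

even-square-minus-self : ∀ x → Even (x * x - x)
even-square-minus-self x with even-or-odd x
... | inj₁ ev = subst Even (lem x) (ℤ∣.∣n⇒∣m*n (x - 1ℤ) ev)
  where lem : ∀ x → (x - 1ℤ) * x ≡ x * x - x
        lem = solve-∀
... | inj₂ od = subst Even (lem x) (ℤ∣.∣m∣n⇒∣m-n (ℤ∣.∣n⇒∣m*n x od) (even-double x))
  where lem : ∀ x → x * (x + 1ℤ) - (x + x) ≡ x * x - x
        lem = solve-∀

-- Lagrange's four-square theorem

record FourSquares (n : ℤ) : Set where
  constructor fourSquares
  field
    a b c d : ℤ
    sum≡ : a * a + b * b + c * c + d * d ≡ n

fourSquares-* : ∀ {x y} → FourSquares x → FourSquares y → FourSquares (x * y)
fourSquares-* (fourSquares a b c d refl) (fourSquares e f g h refl) =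
  fourSquares (a * e + b * f + c * g + d * h) (a * f - b * e + c * h - d * g)
              (a * g - b * h - c * e + d * f) (a * h + b * g - c * f - d * e)
              (euler a b c d e f g h)
  where
  euler : ∀ a b c d e f g h →
      (a * e + b * f + c * g + d * h) * (a * e + b * f + c * g + d * h)
    + (a * f - b * e + c * h - d * g) * (a * f - b * e + c * h - d * g)
    + (a * g - b * h - c * e + d * f) * (a * g - b * h - c * e + d * f)
    + (a * h + b * g - c * f - d * e) * (a * h + b * g - c * f - d * e)
    ≡ (a * a + b * b + c * c + d * d) * (e * e + f * f + g * g + h * h)
  euler = solve-∀

-- x² + y² = 2(u² + v²) with u = (x + y)/2 and v = (x - y)/2.
twoSquares-half : ∀ x y → Even (x - y) → ∃ λ u → ∃ λ v → x * x + y * y ≡ (u * u + v * v) + (u * u + v * v)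
twoSquares-half x y ev with even-half ev
... | v , x-y≡ = y + v , v , trans (cong (λ z → z * z + y * y) (lem₁ x y)) (trans (cong (λ z → (y + z) * (y + z) + y * y) x-y≡) (lem₂ y v))
  where
  lem₁ : ∀ x y → x ≡ y + (x - y)
  lem₁ = solve-∀
  lem₂ : ∀ y v → (y + (v + v)) * (y + (v + v)) + y * y ≡ ((y + v) * (y + v) + v * v) + ((y + v) * (y + v) + v * v)
  lem₂ = solve-∀

evenPairing : ∀ a b c d → Even (a + b + c + d) →
  (Even (a - b) × Even (c - d)) ⊎ (Even (a - c) × Even (b - d)) ⊎ (Even (a - d) × Even (b - c))
evenPairing a b c d ev with even-or-odd (a - b) | even-or-odd (a - c)
... | inj₁ ab | _ = inj₁ (ab , subst Even (lem a b c d) (ℤ∣.∣m∣n⇒∣m-n (ℤ∣.∣m∣n⇒∣m-n ev ab) (ℤ∣.∣m∣n⇒∣m+n (even-double b) (even-double d))))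
  where lem : ∀ a b c d → ((a + b + c + d) - (a - b)) - ((b + b) + (d + d)) ≡ c - d
        lem = solve-∀
... | inj₂ _ | inj₁ ac = inj₂ (inj₁ (ac , subst Even (lem a b c d) (ℤ∣.∣m∣n⇒∣m-n (ℤ∣.∣m∣n⇒∣m-n ev ac) (ℤ∣.∣m∣n⇒∣m+n (even-double c) (even-double d)))))
  where lem : ∀ a b c d → ((a + b + c + d) - (a - c)) - ((c + c) + (d + d)) ≡ b - d
        lem = solve-∀
... | inj₂ ab | inj₂ ac = inj₂ (inj₂ (subst Even (lem₁ a b c d) (ℤ∣.∣m∣n⇒∣m-n (ℤ∣.∣m∣n⇒∣m+n (ℤ∣.∣m∣n⇒∣m+n ab ac) ev) (ℤ∣.∣m∣n⇒∣m+n (even-double (a + 1ℤ)) (even-double d)))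
                               , subst Even (lem₂ a b c) (ℤ∣.∣m∣n⇒∣m-n ac ab)))
  where
  lem₁ : ∀ a b c d → (((a - b + 1ℤ) + (a - c + 1ℤ)) + (a + b + c + d)) - (((a + 1ℤ) + (a + 1ℤ)) + (d + d)) ≡ a - d
  lem₁ = solve-∀
  lem₂ : ∀ a b c → (a - c + 1ℤ) - (a - b + 1ℤ) ≡ b - c
  lem₂ = solve-∀

even-sum-of-four-squares : ∀ a b c d → Even (a * a + b * b + c * c + d * d) → Even (a + b + c + d)
even-sum-of-four-squares a b c d ev = subst Even (lem a b c d) (ℤ∣.∣m∣n⇒∣m-n ev
  (ℤ∣.∣m∣n⇒∣m+n (ℤ∣.∣m∣n⇒∣m+n (ℤ∣.∣m∣n⇒∣m+n (even-square-minus-self a) (even-square-minus-self b)) (even-square-minus-self c)) (even-square-minus-self d)))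
  where lem : ∀ a b c d → (a * a + b * b + c * c + d * d) - ((((a * a - a) + (b * b - b)) + (c * c - c)) + (d * d - d)) ≡ a + b + c + d
        lem = solve-∀

double-injective : ∀ {x y} → x + x ≡ y + y → x ≡ y
double-injective {x} {y} eq = ℤ.*-cancelˡ-≡ (+ 2) x y (trans (lem x) (trans eq (sym (lem y))))
  where lem : ∀ x → + 2 * x ≡ x + x
        lem = solve-∀

fourSquares-fromEvenPairs : ∀ {n} w x y z → Even (w - x) → Even (y - z) → (w * w + x * x) + (y * y + z * z) ≡ n + n → FourSquares n
fourSquares-fromEvenPairs w x y z wx yz sum≡ with twoSquares-half w x wx | twoSquares-half y z yz
... | u , v , wx≡ | s , t , yz≡ = fourSquares u v s t (double-injective (trans (lem u v s t) (trans (sym (cong₂ _+_ wx≡ yz≡)) sum≡)))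
  where lem : ∀ u v s t → (u * u + v * v + s * s + t * t) + (u * u + v * v + s * s + t * t) ≡ ((u * u + v * v) + (u * u + v * v)) + ((s * s + t * t) + (s * s + t * t))
        lem = solve-∀

fourSquares-half : ∀ {n} → FourSquares (n + n) → FourSquares n
fourSquares-half {n} (fourSquares a b c d sum≡) with evenPairing a b c d (even-sum-of-four-squares a b c d (subst Even (sym sum≡) (even-double n)))
... | inj₁ (ab , cd) = fourSquares-fromEvenPairs a b c d ab cd (trans (lem a b c d) sum≡)
  where lem : ∀ a b c d → (a * a + b * b) + (c * c + d * d) ≡ a * a + b * b + c * c + d * d
        lem = solve-∀
... | inj₂ (inj₁ (ac , bd)) = fourSquares-fromEvenPairs a c b d ac bd (trans (lem a b c d) sum≡)
  where lem : ∀ a b c d → (a * a + c * c) + (b * b + d * d) ≡ a * a + b * b + c * c + d * d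
        lem = solve-∀
... | inj₂ (inj₂ (ad , bc)) = fourSquares-fromEvenPairs a d b c ad bc (trans (lem a b c d) sum≡)
  where lem : ∀ a b c d → (a * a + d * d) + (b * b + c * c) ≡ a * a + b * b + c * c + d * d
        lem = solve-∀

%-≡⇒∣∸ : ∀ {a b} p .{{_ : ℕ.NonZero p}} → a % p ≡ b % p → p ∣ a ℕ.∸ b
%-≡⇒∣∸ {a} {b} p a≡b = divides (a / p ℕ.∸ b / p) (begin
  a ℕ.∸ b                                             ≡⟨ cong₂ ℕ._∸_ (m≡m%n+[m/n]*n a p) (m≡m%n+[m/n]*n b p) ⟩
  (a % p ℕ.+ a / p ℕ.* p) ℕ.∸ (b % p ℕ.+ b / p ℕ.* p) ≡⟨ cong (λ z → (a % p ℕ.+ a / p ℕ.* p) ℕ.∸ (z ℕ.+ b / p ℕ.* p)) a≡b ⟨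
  (a % p ℕ.+ a / p ℕ.* p) ℕ.∸ (a % p ℕ.+ b / p ℕ.* p) ≡⟨ ℕ.[m+n]∸[m+o]≡n∸o (a % p) (a / p ℕ.* p) (b / p ℕ.* p) ⟩
  a / p ℕ.* p ℕ.∸ b / p ℕ.* p                         ≡⟨ ℕ.*-distribʳ-∸ p (a / p) (b / p) ⟨
  (a / p ℕ.∸ b / p) ℕ.* p                             ∎)
  where open ≡-Reasoning

square-∸-square : ∀ {u w} → u ℕ.≤ w → w ℕ.* w ℕ.∸ u ℕ.* u ≡ (w ℕ.∸ u) ℕ.* (w ℕ.+ u)
square-∸-square {u} {w} u≤w = begin
  w ℕ.* w ℕ.∸ u ℕ.* u                                           ≡⟨ cong (λ z → z ℕ.* z ℕ.∸ u ℕ.* u) (ℕ.m+[n∸m]≡n u≤w) ⟨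
  (u ℕ.+ (w ℕ.∸ u)) ℕ.* (u ℕ.+ (w ℕ.∸ u)) ℕ.∸ u ℕ.* u           ≡⟨ cong (ℕ._∸ u ℕ.* u) (lem u (w ℕ.∸ u)) ⟩
  u ℕ.* u ℕ.+ (w ℕ.∸ u) ℕ.* ((u ℕ.+ (w ℕ.∸ u)) ℕ.+ u) ℕ.∸ u ℕ.* u ≡⟨ ℕ.m+n∸m≡n (u ℕ.* u) _ ⟩
  (w ℕ.∸ u) ℕ.* ((u ℕ.+ (w ℕ.∸ u)) ℕ.+ u)                       ≡⟨ cong (λ z → (w ℕ.∸ u) ℕ.* (z ℕ.+ u)) (ℕ.m+[n∸m]≡n u≤w) ⟩
  (w ℕ.∸ u) ℕ.* (w ℕ.+ u)                                       ∎
  where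
  open ≡-Reasoning
  lem : ∀ u e → (u ℕ.+ e) ℕ.* (u ℕ.+ e) ≡ u ℕ.* u ℕ.+ e ℕ.* ((u ℕ.+ e) ℕ.+ u)
  lem = solveℕ-∀

module _ (h : ℕ) (p-prime : Prime (suc (h ℕ.+ h))) where
  private
    p = suc (h ℕ.+ h)
    0<h : 0 ℕ.< h
    0<h = ℕ.n≢0⇒n>0 λ { refl → ¬prime[1] p-prime }

  squares-distinct-mod : ∀ {u w} → u ℕ.< w → w ℕ.≤ h → (u ℕ.* u) % p ≢ (w ℕ.* w) % p
  squares-distinct-mod {u} {w} u<w w≤h u²≡w²
    with euclidsLemma (w ℕ.∸ u) (w ℕ.+ u) p-prime (subst (p ∣_) (square-∸-square (ℕ.<⇒≤ u<w)) (%-≡⇒∣∸ {w ℕ.* w} {u ℕ.* u} p (sym u²≡w²)))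
  ... | inj₁ p∣w-u = ℕ.<⇒≱ (ℕ.≤-<-trans (ℕ.≤-trans (ℕ.m∸n≤m w u) w≤h) (ℕ.s≤s (ℕ.m≤m+n h h)))
                      (∣⇒≤ {{ℕ.>-nonZero (ℕ.m<n⇒0<n∸m u<w)}} p∣w-u)
  ... | inj₂ p∣w+u = ℕ.<⇒≱ (ℕ.s≤s (ℕ.+-mono-≤ w≤h (ℕ.≤-trans (ℕ.<⇒≤ u<w) w≤h)))
                      (∣⇒≤ {{ℕ.>-nonZero (ℕ.<-≤-trans (ℕ.≤-<-trans ℕ.z≤n u<w) (ℕ.m≤m+n w u))}} p∣w+u)

  multipleOfPrime-fromResidues : ∀ x u → x ℕ.≤ h → u ℕ.≤ h → (x ℕ.* x) % p ≡ (h ℕ.+ h) ℕ.∸ ((u ℕ.* u) % p) →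
                                 ∃ λ k → 0 ℕ.< k × k ℕ.< p × FourSquares (+ k * + p)
  multipleOfPrime-fromResidues x u x≤h u≤h x²≡-1-u² = suc (A ℕ.+ B) , ℕ.z<s , k<p , fourSquares (+ x) (+ u) 1ℤ (+ 0) sum≡
    where
    A = (x ℕ.* x) / p
    B = (u ℕ.* u) / p
    residues : (x ℕ.* x) % p ℕ.+ (u ℕ.* u) % p ≡ h ℕ.+ h
    residues = trans (cong (ℕ._+ (u ℕ.* u) % p) x²≡-1-u²) (ℕ.m∸n+n≡m (ℕ.s≤s⁻¹ (m%n<n (u ℕ.* u) p)))
    x²+u²+1 : x ℕ.* x ℕ.+ u ℕ.* u ℕ.+ 1 ≡ suc (A ℕ.+ B) ℕ.* p
    x²+u²+1 = begin
      x ℕ.* x ℕ.+ u ℕ.* u ℕ.+ 1                                        ≡⟨ cong₂ (λ a b → a ℕ.+ b ℕ.+ 1) (m≡m%n+[m/n]*n (x ℕ.* x) p) (m≡m%n+[m/n]*n (u ℕ.* u) p) ⟩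
      ((x ℕ.* x) % p ℕ.+ A ℕ.* p) ℕ.+ ((u ℕ.* u) % p ℕ.+ B ℕ.* p) ℕ.+ 1 ≡⟨ lem₁ ((x ℕ.* x) % p) ((u ℕ.* u) % p) A B p ⟩
      ((x ℕ.* x) % p ℕ.+ (u ℕ.* u) % p) ℕ.+ 1 ℕ.+ (A ℕ.+ B) ℕ.* p      ≡⟨ cong (λ z → z ℕ.+ 1 ℕ.+ (A ℕ.+ B) ℕ.* p) residues ⟩
      (h ℕ.+ h) ℕ.+ 1 ℕ.+ (A ℕ.+ B) ℕ.* p                              ≡⟨ lem₂ h A B ⟩
      suc (A ℕ.+ B) ℕ.* p                                              ∎
      where
      open ≡-Reasoning
      lem₁ : ∀ α β A B p → (α ℕ.+ A ℕ.* p) ℕ.+ (β ℕ.+ B ℕ.* p) ℕ.+ 1 ≡ (α ℕ.+ β) ℕ.+ 1 ℕ.+ (A ℕ.+ B) ℕ.* p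
      lem₁ = solveℕ-∀
      lem₂ : ∀ h A B → (h ℕ.+ h) ℕ.+ 1 ℕ.+ (A ℕ.+ B) ℕ.* (1 ℕ.+ (h ℕ.+ h)) ≡ (1 ℕ.+ (A ℕ.+ B)) ℕ.* (1 ℕ.+ (h ℕ.+ h))
      lem₂ = solveℕ-∀
    k<p : suc (A ℕ.+ B) ℕ.< p
    k<p = ℕ.*-cancelʳ-< p (suc (A ℕ.+ B)) p (subst (ℕ._< p ℕ.* p) x²+u²+1 (ℕ.≤-<-trans
            (ℕ.+-monoˡ-≤ 1 (ℕ.+-mono-≤ (ℕ.*-mono-≤ x≤h x≤h) (ℕ.*-mono-≤ u≤h u≤h)))
            (subst (h ℕ.* h ℕ.+ h ℕ.* h ℕ.+ 1 ℕ.<_) (sym (lem h)) (ℕ.m<m+n (h ℕ.* h ℕ.+ h ℕ.* h ℕ.+ 1) (ℕ.<-≤-trans 0<h (ℕ.m≤m+n h _))))))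
      where lem : ∀ h → (1 ℕ.+ (h ℕ.+ h)) ℕ.* (1 ℕ.+ (h ℕ.+ h)) ≡ (h ℕ.* h ℕ.+ h ℕ.* h ℕ.+ 1) ℕ.+ (h ℕ.+ (h ℕ.+ h ℕ.+ h ℕ.+ h ℕ.* h ℕ.+ h ℕ.* h))
            lem = solveℕ-∀
    sum≡ : + x * + x + + u * + u + 1ℤ * 1ℤ + + 0 * + 0 ≡ + suc (A ℕ.+ B) * + p
    sum≡ = trans (cong₂ (λ a b → a + b + 1ℤ + + 0) (sym (ℤ.pos-* x x)) (sym (ℤ.pos-* u u)))
            (trans (ℤ.+-identityʳ _)
            (trans (sym (trans (ℤ.pos-+ (x ℕ.* x ℕ.+ u ℕ.* u) 1) (cong (_+ 1ℤ) (ℤ.pos-+ (x ℕ.* x) (u ℕ.* u)))))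
            (trans (cong +_ x²+u²+1) (ℤ.pos-* (suc (A ℕ.+ B)) p))))

  -- The h + 1 residues of x² and the h + 1 residues of −1 − u² (0 ≤ x, u ≤ h) are
  -- p + 1 values in ℤ/p, so two of them collide; squares alone are pairwise distinct.
  residue : ℕ → ℕ
  residue j with j ≤? h
  ... | yes _ = (j ℕ.* j) % p
  ... | no _  = (h ℕ.+ h) ℕ.∸ (((j ℕ.∸ suc h) ℕ.* (j ℕ.∸ suc h)) % p)

  residue-≤ : ∀ {j} → j ℕ.≤ h → residue j ≡ (j ℕ.* j) % p
  residue-≤ {j} j≤h with j ≤? h
  ... | yes _ = refl
  ... | no j≰h = ⊥-elim (j≰h j≤h)

  residue-> : ∀ {j} → ¬ j ℕ.≤ h → residue j ≡ (h ℕ.+ h) ℕ.∸ (((j ℕ.∸ suc h) ℕ.* (j ℕ.∸ suc h)) % p)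
  residue-> {j} j≰h with j ≤? h
  ... | yes j≤h = ⊥-elim (j≰h j≤h)
  ... | no _ = refl

  residue<p : ∀ j → residue j ℕ.< p
  residue<p j with j ≤? h
  ... | yes _ = m%n<n (j ℕ.* j) p
  ... | no _  = ℕ.s≤s (ℕ.m∸n≤m (h ℕ.+ h) (((j ℕ.∸ suc h) ℕ.* (j ℕ.∸ suc h)) % p))

  shifted-≤ : ∀ {y} → y ℕ.≤ p → y ℕ.∸ suc h ℕ.≤ h
  shifted-≤ y≤p = ℕ.≤-trans (ℕ.∸-monoˡ-≤ (suc h) y≤p) (ℕ.≤-reflexive (ℕ.m+n∸m≡n h h))

  residue-collision : ∀ {x y} → x ℕ.< y → y ℕ.≤ p → residue x ≡ residue y →
                      ∃ λ k → 0 ℕ.< k × k ℕ.< p × FourSquares (+ k * + p)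
  residue-collision {x} {y} x<y y≤p x≡y = cases (y ≤? h) (x ≤? h)
    where
    cases : Dec (y ℕ.≤ h) → Dec (x ℕ.≤ h) → ∃ λ k → 0 ℕ.< k × k ℕ.< p × FourSquares (+ k * + p)
    cases (yes y≤h) _ = ⊥-elim (squares-distinct-mod x<y y≤h
      (trans (sym (residue-≤ (ℕ.≤-trans (ℕ.<⇒≤ x<y) y≤h))) (trans x≡y (residue-≤ y≤h))))
    cases (no y≰h) (yes x≤h) = multipleOfPrime-fromResidues x (y ℕ.∸ suc h) x≤h (shifted-≤ y≤p)
      (trans (sym (residue-≤ x≤h)) (trans x≡y (residue-> y≰h)))
    cases (no y≰h) (no x≰h) = ⊥-elim (squares-distinct-mod (ℕ.∸-monoˡ-< x<y (ℕ.≰⇒> x≰h)) (shifted-≤ y≤p)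
      (ℕ.∸-cancelˡ-≡ (residue≤2h (x ℕ.∸ suc h)) (residue≤2h (y ℕ.∸ suc h))
        (trans (sym (residue-> x≰h)) (trans x≡y (residue-> y≰h)))))
      where
      residue≤2h : ∀ z → (z ℕ.* z) % p ℕ.≤ h ℕ.+ h
      residue≤2h z = ℕ.s≤s⁻¹ (m%n<n (z ℕ.* z) p)

  multipleOfPrime-isFourSquares : ∃ λ k → 0 ℕ.< k × k ℕ.< p × FourSquares (+ k * + p)
  multipleOfPrime-isFourSquares with Fin.pigeonhole (ℕ.n<1+n p) (λ j → fromℕ< (residue<p (toℕ j)))
  ... | i , j , i<j , i≡j = residue-collision i<j (ℕ.s≤s⁻¹ (Fin.toℕ<n j))
          (trans (sym (Fin.toℕ-fromℕ< (residue<p (toℕ i)))) (trans (cong toℕ i≡j) (Fin.toℕ-fromℕ< (residue<p (toℕ j)))))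

square-abs : ∀ x → x * x ≡ + (∣ x ∣ ℕ.* ∣ x ∣)
square-abs (+ n)    = sym (ℤ.pos-* n n)
square-abs -[1+ n ] = refl

balancedRemainder : ∀ h a → ∃ λ q → ∣ a - q * + suc (h ℕ.+ h) ∣ ℕ.≤ h
balancedRemainder h a = choose (a ℤ.%ℕ k) (ℤ.n%ℕd<d a k) (ℤ.a≡a%ℕn+[a/ℕn]*n a k)
  where
  k = suc (h ℕ.+ h)
  q = a ℤ./ℕ k
  choose : ∀ r → r ℕ.< k → a ≡ + r + q * + k → ∃ λ q → ∣ a - q * + k ∣ ℕ.≤ h
  choose r r<k a≡ with r ≤? h
  ... | yes r≤h = q , subst (ℕ._≤ h) (cong ∣_∣ (sym a-qk≡r)) r≤h
    where
    a-qk≡r : a - q * + k ≡ + r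
    a-qk≡r = trans (cong (_- q * + k) a≡) (lem (+ r) q (+ k))
      where lem : ∀ r q k → r + q * k - q * k ≡ r
            lem = solve-∀
  ... | no r≰h = q + 1ℤ , subst (ℕ._≤ h) (sym ∣a-qk∣≡k-r) k-r≤h
    where
    ∣a-qk∣≡k-r : ∣ a - (q + 1ℤ) * + k ∣ ≡ k ℕ.∸ r
    ∣a-qk∣≡k-r = begin
      ∣ a - (q + 1ℤ) * + k ∣             ≡⟨ cong (λ z → ∣ z - (q + 1ℤ) * + k ∣) a≡ ⟩
      ∣ + r + q * + k - (q + 1ℤ) * + k ∣ ≡⟨ cong ∣_∣ (lem (+ r) q (+ k)) ⟩
      ∣ + r - + k ∣                      ≡⟨ ℤ.∣i-j∣≡∣j-i∣ (+ r) (+ k) ⟩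
      ∣ + k - + r ∣                      ≡⟨ cong ∣_∣ (trans (ℤ.m-n≡m⊖n k r) (ℤ.⊖-≥ (ℕ.<⇒≤ r<k))) ⟩
      k ℕ.∸ r                            ∎
      where
      open ≡-Reasoning
      lem : ∀ r q k → r + q * k - (q + 1ℤ) * k ≡ r - k
      lem = solve-∀
    k-r≤h : k ℕ.∸ r ℕ.≤ h
    k-r≤h = ℕ.≤-trans (ℕ.∸-monoʳ-≤ k (ℕ.≰⇒> r≰h)) (ℕ.≤-reflexive (ℕ.m+n∸m≡n h h))

sumOfFourSquares-reduced : ∀ a₁ a₂ a₃ a₄ q₁ q₂ q₃ q₄ K P →
    (a₁ - q₁ * K) * (a₁ - q₁ * K) + (a₂ - q₂ * K) * (a₂ - q₂ * K) + (a₃ - q₃ * K) * (a₃ - q₃ * K) + (a₄ - q₄ * K) * (a₄ - q₄ * K)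
  ≡ ((a₁ * a₁ + a₂ * a₂ + a₃ * a₃ + a₄ * a₄) - K * P)
    + K * (P - (a₁ * q₁ + a₂ * q₂ + a₃ * q₃ + a₄ * q₄) * + 2 + K * (q₁ * q₁ + q₂ * q₂ + q₃ * q₃ + q₄ * q₄))
sumOfFourSquares-reduced = solve-∀

-- Euler's identity for (a) and (a − q K), in which each of the four products is a multiple of K.
euler-reduced : ∀ a₁ a₂ a₃ a₄ q₁ q₂ q₃ q₄ K →
  let A = a₁ * a₁ + a₂ * a₂ + a₃ * a₃ + a₄ * a₄ in
    (A - K * (a₁ * q₁ + a₂ * q₂ + a₃ * q₃ + a₄ * q₄)) * (A - K * (a₁ * q₁ + a₂ * q₂ + a₃ * q₃ + a₄ * q₄))
  + (K * (a₂ * q₁ - a₁ * q₂ + a₄ * q₃ - a₃ * q₄)) * (K * (a₂ * q₁ - a₁ * q₂ + a₄ * q₃ - a₃ * q₄))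
  + (K * (a₃ * q₁ - a₁ * q₃ + a₂ * q₄ - a₄ * q₂)) * (K * (a₃ * q₁ - a₁ * q₃ + a₂ * q₄ - a₄ * q₂))
  + (K * (a₄ * q₁ - a₁ * q₄ + a₃ * q₂ - a₂ * q₃)) * (K * (a₄ * q₁ - a₁ * q₄ + a₃ * q₂ - a₂ * q₃))
  ≡ A * ((a₁ - q₁ * K) * (a₁ - q₁ * K) + (a₂ - q₂ * K) * (a₂ - q₂ * K) + (a₃ - q₃ * K) * (a₃ - q₃ * K) + (a₄ - q₄ * K) * (a₄ - q₄ * K))
euler-reduced = solve-∀

descentAlgebra : ∀ K P a₁ a₂ a₃ a₄ q₁ q₂ q₃ q₄ .{{_ : ℤ.NonZero K}} →
  a₁ * a₁ + a₂ * a₂ + a₃ * a₃ + a₄ * a₄ ≡ K * P →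
  ∃ λ R → (a₁ - q₁ * K) * (a₁ - q₁ * K) + (a₂ - q₂ * K) * (a₂ - q₂ * K) + (a₃ - q₃ * K) * (a₃ - q₃ * K) + (a₄ - q₄ * K) * (a₄ - q₄ * K) ≡ K * R
        × FourSquares (P * R)
descentAlgebra K P a₁ a₂ a₃ a₄ q₁ q₂ q₃ q₄ ΣA≡KP =
  R , ΣB≡KR , fourSquares d₁ d₂ d₃ d₄ (ℤ.*-cancelˡ-≡ (K * K) _ _ {{ℤ.i*j≢0 K K}} K²Σd²≡K²PR)
  where
  A = a₁ * a₁ + a₂ * a₂ + a₃ * a₃ + a₄ * a₄
  Σaq = a₁ * q₁ + a₂ * q₂ + a₃ * q₃ + a₄ * q₄
  R = P - Σaq * + 2 + K * (q₁ * q₁ + q₂ * q₂ + q₃ * q₃ + q₄ * q₄)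
  d₁ = P - Σaq
  d₂ = a₂ * q₁ - a₁ * q₂ + a₄ * q₃ - a₃ * q₄
  d₃ = a₃ * q₁ - a₁ * q₃ + a₂ * q₄ - a₄ * q₂
  d₄ = a₄ * q₁ - a₁ * q₄ + a₃ * q₂ - a₂ * q₃
  ΣB≡KR : (a₁ - q₁ * K) * (a₁ - q₁ * K) + (a₂ - q₂ * K) * (a₂ - q₂ * K) + (a₃ - q₃ * K) * (a₃ - q₃ * K) + (a₄ - q₄ * K) * (a₄ - q₄ * K) ≡ K * R
  ΣB≡KR = trans (sumOfFourSquares-reduced a₁ a₂ a₃ a₄ q₁ q₂ q₃ q₄ K P)
                (trans (cong (_+ K * R) (ℤ.i≡j⇒i-j≡0 ΣA≡KP)) (ℤ.+-identityˡ (K * R)))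
  Kd₁≡ : K * d₁ ≡ A - K * Σaq
  Kd₁≡ = trans (lem K P Σaq) (cong (_- K * Σaq) (sym ΣA≡KP))
    where lem : ∀ K P x → K * (P - x) ≡ K * P - K * x
          lem = solve-∀
  K²Σd²≡K²PR : K * K * (d₁ * d₁ + d₂ * d₂ + d₃ * d₃ + d₄ * d₄) ≡ K * K * (P * R)
  K²Σd²≡K²PR = begin
    K * K * (d₁ * d₁ + d₂ * d₂ + d₃ * d₃ + d₄ * d₄)                                   ≡⟨ lem₁ K d₁ d₂ d₃ d₄ ⟩
    (K * d₁) * (K * d₁) + (K * d₂) * (K * d₂) + (K * d₃) * (K * d₃) + (K * d₄) * (K * d₄) ≡⟨ cong (λ z → z * z + (K * d₂) * (K * d₂) + (K * d₃) * (K * d₃) + (K * d₄) * (K * d₄)) Kd₁≡ ⟩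
    (A - K * Σaq) * (A - K * Σaq) + (K * d₂) * (K * d₂) + (K * d₃) * (K * d₃) + (K * d₄) * (K * d₄) ≡⟨ euler-reduced a₁ a₂ a₃ a₄ q₁ q₂ q₃ q₄ K ⟩
    A * _                                                                             ≡⟨ cong₂ _*_ ΣA≡KP ΣB≡KR ⟩
    (K * P) * (K * R)                                                                 ≡⟨ lem₂ K P R ⟩
    K * K * (P * R)                                                                   ∎
    where
    open ≡-Reasoning
    lem₁ : ∀ K d₁ d₂ d₃ d₄ → K * K * (d₁ * d₁ + d₂ * d₂ + d₃ * d₃ + d₄ * d₄) ≡
      (K * d₁) * (K * d₁) + (K * d₂) * (K * d₂) + (K * d₃) * (K * d₃) + (K * d₄) * (K * d₄)
    lem₁ = solve-∀
    lem₂ : ∀ K P R → (K * P) * (K * R) ≡ K * K * (P * R)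
    lem₂ = solve-∀

sumOfFourSquares-abs : ∀ b₁ b₂ b₃ b₄ → b₁ * b₁ + b₂ * b₂ + b₃ * b₃ + b₄ * b₄ ≡
  + (∣ b₁ ∣ ℕ.* ∣ b₁ ∣ ℕ.+ ∣ b₂ ∣ ℕ.* ∣ b₂ ∣ ℕ.+ ∣ b₃ ∣ ℕ.* ∣ b₃ ∣ ℕ.+ ∣ b₄ ∣ ℕ.* ∣ b₄ ∣)
sumOfFourSquares-abs b₁ b₂ b₃ b₄ = begin
  b₁ * b₁ + b₂ * b₂ + b₃ * b₃ + b₄ * b₄ ≡⟨ cong₂ _+_ (cong₂ _+_ (cong₂ _+_ (square-abs b₁) (square-abs b₂)) (square-abs b₃)) (square-abs b₄) ⟩
  + s₁ + + s₂ + + s₃ + + s₄ ≡⟨ cong (λ z → z + + s₃ + + s₄) (ℤ.pos-+ s₁ s₂) ⟨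
  + (s₁ ℕ.+ s₂) + + s₃ + + s₄ ≡⟨ cong (_+ + s₄) (ℤ.pos-+ (s₁ ℕ.+ s₂) s₃) ⟨
  + (s₁ ℕ.+ s₂ ℕ.+ s₃) + + s₄ ≡⟨ ℤ.pos-+ (s₁ ℕ.+ s₂ ℕ.+ s₃) s₄ ⟨
  + (s₁ ℕ.+ s₂ ℕ.+ s₃ ℕ.+ s₄) ∎
  where
  open ≡-Reasoning
  s₁ = ∣ b₁ ∣ ℕ.* ∣ b₁ ∣
  s₂ = ∣ b₂ ∣ ℕ.* ∣ b₂ ∣
  s₃ = ∣ b₃ ∣ ℕ.* ∣ b₃ ∣
  s₄ = ∣ b₄ ∣ ℕ.* ∣ b₄ ∣

sumOfFourSquares-< : ∀ {h s₁ s₂ s₃ s₄} → s₁ ℕ.≤ h → s₂ ℕ.≤ h → s₃ ℕ.≤ h → s₄ ℕ.≤ h →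
  s₁ ℕ.* s₁ ℕ.+ s₂ ℕ.* s₂ ℕ.+ s₃ ℕ.* s₃ ℕ.+ s₄ ℕ.* s₄ ℕ.< suc (h ℕ.+ h) ℕ.* suc (h ℕ.+ h)
sumOfFourSquares-< {h} s₁≤h s₂≤h s₃≤h s₄≤h = ℕ.≤-<-trans
  (ℕ.+-mono-≤ (ℕ.+-mono-≤ (ℕ.+-mono-≤ (ℕ.*-mono-≤ s₁≤h s₁≤h) (ℕ.*-mono-≤ s₂≤h s₂≤h)) (ℕ.*-mono-≤ s₃≤h s₃≤h)) (ℕ.*-mono-≤ s₄≤h s₄≤h))
  (subst (4h² ℕ.<_) (sym (lem h)) (ℕ.m<m+n 4h² ℕ.z<s))
  where
  4h² = h ℕ.* h ℕ.+ h ℕ.* h ℕ.+ h ℕ.* h ℕ.+ h ℕ.* h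
  lem : ∀ h → suc (h ℕ.+ h) ℕ.* suc (h ℕ.+ h) ≡ (h ℕ.* h ℕ.+ h ℕ.* h ℕ.+ h ℕ.* h ℕ.+ h ℕ.* h) ℕ.+ suc (h ℕ.+ h ℕ.+ h ℕ.+ h)
  lem = solveℕ-∀

square≡0 : ∀ {s} → s ℕ.* s ≡ 0 → s ≡ 0
square≡0 {s} s²≡0 = reduce (ℕ.m*n≡0⇒m≡0∨n≡0 s s²≡0)

sumOfFourSquares≡0 : ∀ s₁ s₂ s₃ s₄ → s₁ ℕ.* s₁ ℕ.+ s₂ ℕ.* s₂ ℕ.+ s₃ ℕ.* s₃ ℕ.+ s₄ ℕ.* s₄ ≡ 0 →
                     s₁ ≡ 0 × s₂ ≡ 0 × s₃ ≡ 0 × s₄ ≡ 0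
sumOfFourSquares≡0 s₁ s₂ s₃ s₄ Σ≡0 =
  square≡0 (ℕ.m+n≡0⇒m≡0 _ Σ₂≡0) , square≡0 (ℕ.m+n≡0⇒n≡0 (s₁ ℕ.* s₁) Σ₂≡0) ,
  square≡0 (ℕ.m+n≡0⇒n≡0 (s₁ ℕ.* s₁ ℕ.+ s₂ ℕ.* s₂) Σ₃≡0) , square≡0 (ℕ.m+n≡0⇒n≡0 (s₁ ℕ.* s₁ ℕ.+ s₂ ℕ.* s₂ ℕ.+ s₃ ℕ.* s₃) Σ≡0)
  where
  Σ₃≡0 = ℕ.m+n≡0⇒m≡0 (s₁ ℕ.* s₁ ℕ.+ s₂ ℕ.* s₂ ℕ.+ s₃ ℕ.* s₃) Σ≡0
  Σ₂≡0 = ℕ.m+n≡0⇒m≡0 (s₁ ℕ.* s₁ ℕ.+ s₂ ℕ.* s₂) Σ₃≡0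

sumOfFourSquaresOfMultiples-∣ : ∀ {K P} q₁ q₂ q₃ q₄ .{{_ : ℤ.NonZero K}} →
  (q₁ * K) * (q₁ * K) + (q₂ * K) * (q₂ * K) + (q₃ * K) * (q₃ * K) + (q₄ * K) * (q₄ * K) ≡ K * P → K ℤ∣.∣ P
sumOfFourSquaresOfMultiples-∣ {K} {P} q₁ q₂ q₃ q₄ Σ≡KP =
  ℤ∣.divides Q (trans (sym (ℤ.*-cancelˡ-≡ K _ _ (trans (sym (lem q₁ q₂ q₃ q₄ K)) Σ≡KP))) (ℤ.*-comm K Q))
  where
  Q = q₁ * q₁ + q₂ * q₂ + q₃ * q₃ + q₄ * q₄
  lem : ∀ q₁ q₂ q₃ q₄ K → (q₁ * K) * (q₁ * K) + (q₂ * K) * (q₂ * K) + (q₃ * K) * (q₃ * K) + (q₄ * K) * (q₄ * K) ≡ K * (K * (q₁ * q₁ + q₂ * q₂ + q₃ * q₃ + q₄ * q₄))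
  lem = solve-∀

reducedSquares≡0⇒∣ : ∀ {K P} a₁ a₂ a₃ a₄ q₁ q₂ q₃ q₄ .{{_ : ℤ.NonZero K}} → a₁ * a₁ + a₂ * a₂ + a₃ * a₃ + a₄ * a₄ ≡ K * P →
  ∣ a₁ - q₁ * K ∣ ℕ.* ∣ a₁ - q₁ * K ∣ ℕ.+ ∣ a₂ - q₂ * K ∣ ℕ.* ∣ a₂ - q₂ * K ∣ ℕ.+
  ∣ a₃ - q₃ * K ∣ ℕ.* ∣ a₃ - q₃ * K ∣ ℕ.+ ∣ a₄ - q₄ * K ∣ ℕ.* ∣ a₄ - q₄ * K ∣ ≡ 0 → K ℤ∣.∣ P
reducedSquares≡0⇒∣ {K} {P} a₁ a₂ a₃ a₄ q₁ q₂ q₃ q₄ ΣA≡KP Σb²≡0 =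
  let (b₁≡0 , b₂≡0 , b₃≡0 , b₄≡0) = sumOfFourSquares≡0 (∣ a₁ - q₁ * K ∣) (∣ a₂ - q₂ * K ∣) (∣ a₃ - q₃ * K ∣) (∣ a₄ - q₄ * K ∣) Σb²≡0
  in sumOfFourSquaresOfMultiples-∣ q₁ q₂ q₃ q₄
       (subst₂ (λ x y → x * x + y * y + (q₃ * K) * (q₃ * K) + (q₄ * K) * (q₄ * K) ≡ K * P) (multiple a₁ q₁ b₁≡0) (multiple a₂ q₂ b₂≡0)
         (subst₂ (λ x y → a₁ * a₁ + a₂ * a₂ + x * x + y * y ≡ K * P) (multiple a₃ q₃ b₃≡0) (multiple a₄ q₄ b₄≡0) ΣA≡KP))
  where
  multiple : ∀ a q → ∣ a - q * K ∣ ≡ 0 → a ≡ q * K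
  multiple a q ∣a-qK∣≡0 = ℤ.i-j≡0⇒i≡j a (q * K) (ℤ.∣i∣≡0⇒i≡0 ∣a-qK∣≡0)

pos-factor : ∀ k {s} R → + s ≡ + suc k * R → ∃ λ r → R ≡ + r × s ≡ suc k ℕ.* r
pos-factor k (+ r) s≡kr = r , refl , ℤ.+-injective (trans s≡kr (sym (ℤ.pos-* (suc k) r)))

-- The descent step: reduce each aᵢ into (−k/2, k/2) modulo the odd k.
oddDescent : ∀ {p} h → Prime p → 0 ℕ.< h → suc (h ℕ.+ h) ℕ.< p → FourSquares (+ suc (h ℕ.+ h) * + p) →
             ∃ λ r → 0 ℕ.< r × r ℕ.< suc (h ℕ.+ h) × FourSquares (+ r * + p)
oddDescent {p} h p-prime 0<h k<p (fourSquares a₁ a₂ a₃ a₄ ΣA≡KP) =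
  let (q₁ , s₁≤h) = balancedRemainder h a₁
      (q₂ , s₂≤h) = balancedRemainder h a₂
      (q₃ , s₃≤h) = balancedRemainder h a₃
      (q₄ , s₄≤h) = balancedRemainder h a₄
      (R , ΣB≡KR , fourSquares-PR) = descentAlgebra K (+ p) a₁ a₂ a₃ a₄ q₁ q₂ q₃ q₄ ΣA≡KP
  in descend q₁ q₂ q₃ q₄ s₁≤h s₂≤h s₃≤h s₄≤h R ΣB≡KR fourSquares-PR
  where
  k = suc (h ℕ.+ h)
  K = + k
  descend : ∀ q₁ q₂ q₃ q₄ → ∣ a₁ - q₁ * K ∣ ℕ.≤ h → ∣ a₂ - q₂ * K ∣ ℕ.≤ h → ∣ a₃ - q₃ * K ∣ ℕ.≤ h → ∣ a₄ - q₄ * K ∣ ℕ.≤ h →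
           ∀ R → (a₁ - q₁ * K) * (a₁ - q₁ * K) + (a₂ - q₂ * K) * (a₂ - q₂ * K) + (a₃ - q₃ * K) * (a₃ - q₃ * K) + (a₄ - q₄ * K) * (a₄ - q₄ * K) ≡ K * R →
           FourSquares (+ p * R) → ∃ λ r → 0 ℕ.< r × r ℕ.< k × FourSquares (+ r * + p)
  descend q₁ q₂ q₃ q₄ s₁≤h s₂≤h s₃≤h s₄≤h R ΣB≡KR fourSquares-PR =
    r , ℕ.n≢0⇒n>0 r≢0 , r<k , subst FourSquares (trans (cong (+ p *_) R≡r) (ℤ.*-comm (+ p) (+ r))) fourSquares-PR
    where
    b₁ = a₁ - q₁ * K
    b₂ = a₂ - q₂ * K
    b₃ = a₃ - q₃ * K
    b₄ = a₄ - q₄ * K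
    Σ∣b∣² = ∣ b₁ ∣ ℕ.* ∣ b₁ ∣ ℕ.+ ∣ b₂ ∣ ℕ.* ∣ b₂ ∣ ℕ.+ ∣ b₃ ∣ ℕ.* ∣ b₃ ∣ ℕ.+ ∣ b₄ ∣ ℕ.* ∣ b₄ ∣
    nonneg = pos-factor (h ℕ.+ h) R (trans (sym (sumOfFourSquares-abs b₁ b₂ b₃ b₄)) ΣB≡KR)
    r = proj₁ nonneg
    R≡r : R ≡ + r
    R≡r = proj₁ (proj₂ nonneg)
    Σ∣b∣²≡kr : Σ∣b∣² ≡ k ℕ.* r
    Σ∣b∣²≡kr = proj₂ (proj₂ nonneg)
    r<k : r ℕ.< k
    r<k = ℕ.*-cancelˡ-< k r k (subst (ℕ._< k ℕ.* k) Σ∣b∣²≡kr (sumOfFourSquares-< s₁≤h s₂≤h s₃≤h s₄≤h))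
    r≢0 : r ≢ 0
    r≢0 r≡0 = Prime.notComposite p-prime (composite k<p (ℤ∣.∣⇒∣ᵤ {K} {+ p}
      (reducedSquares≡0⇒∣ a₁ a₂ a₃ a₄ q₁ q₂ q₃ q₄ ΣA≡KP (trans Σ∣b∣²≡kr (trans (cong (k ℕ.*_) r≡0) (ℕ.*-zeroʳ k))))))
      where
      instance
        k-nonTrivial : ℕ.NonTrivial k
        k-nonTrivial = ℕ.n>1⇒nonTrivial (ℕ.s≤s (ℕ.<-≤-trans 0<h (ℕ.m≤m+n h h)))

halve : ∀ n → ∃ λ h → n ≡ h ℕ.+ h ⊎ n ≡ suc (h ℕ.+ h)
halve zero = 0 , inj₁ refl
halve (suc n) with halve n
... | h , inj₁ refl = h , inj₂ refl
... | h , inj₂ refl = suc h , inj₁ (cong suc (sym (ℕ.+-suc h h)))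

2∣h+h : ∀ h → 2 ∣ h ℕ.+ h
2∣h+h h = divides h (trans (cong (h ℕ.+_) (sym (ℕ.+-identityʳ h))) (ℕ.*-comm 2 h))

descent : ∀ {p} → Prime p → ∀ k → 0 ℕ.< k → k ℕ.< p → FourSquares (+ k * + p) → FourSquares (+ p)
descent {p} p-prime = <-rec _ step
  where
  step : ∀ k → (∀ {j} → j ℕ.< k → 0 ℕ.< j → j ℕ.< p → FourSquares (+ j * + p) → FourSquares (+ p)) →
         0 ℕ.< k → k ℕ.< p → FourSquares (+ k * + p) → FourSquares (+ p)
  step k rec 0<k k<p kp with halve k
  ... | h , inj₁ refl = rec h<k 0<h (ℕ.<-trans h<k k<p) (fourSquares-half (subst FourSquares 2hp≡hp+hp kp))
    where
    0<h : 0 ℕ.< h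
    0<h = ℕ.n≢0⇒n>0 λ { refl → ℕ.<-irrefl refl 0<k }
    h<k : h ℕ.< h ℕ.+ h
    h<k = ℕ.m<m+n h 0<h
    2hp≡hp+hp : + (h ℕ.+ h) * + p ≡ + h * + p + + h * + p
    2hp≡hp+hp = trans (cong (_* + p) (ℤ.pos-+ h h)) (ℤ.*-distribʳ-+ (+ p) (+ h) (+ h))
  ... | zero , inj₂ refl = subst FourSquares (ℤ.*-identityˡ (+ p)) kp
  ... | suc h , inj₂ refl =
    let (r , 0<r , r<k , rp) = oddDescent (suc h) p-prime ℕ.z<s k<p kp
    in rec r<k 0<r (ℕ.<-trans r<k k<p) rp

fourSquares-prime : ∀ {p} → Prime p → FourSquares (+ p)
fourSquares-prime {p} p-prime with halve p
... | zero , inj₂ refl = ⊥-elim (¬prime[1] p-prime)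
... | suc h , inj₂ refl =
  let (k , 0<k , k<p , kp) = multipleOfPrime-isFourSquares (suc h) p-prime
  in descent p-prime k 0<k k<p kp
... | h , inj₁ refl with prime⇒irreducible p-prime (2∣h+h h)
...   | inj₁ ()
...   | inj₂ 2≡p = subst (λ n → FourSquares (+ n)) 2≡p (fourSquares 1ℤ 1ℤ 0ℤ 0ℤ refl)

fourSquares-productOfPrimes : ∀ {ps} → All Prime ps → FourSquares (+ product ps)
fourSquares-productOfPrimes All.[] = fourSquares 1ℤ 0ℤ 0ℤ 0ℤ refl
fourSquares-productOfPrimes (All._∷_ {p} {ps} p-prime ps-prime) =
  subst FourSquares (sym (ℤ.pos-* p (product ps))) (fourSquares-* (fourSquares-prime p-prime) (fourSquares-productOfPrimes ps-prime))

lagrangeFourSquares : ∀ n → FourSquares (+ n)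
lagrangeFourSquares zero = fourSquares 0ℤ 0ℤ 0ℤ 0ℤ refl
lagrangeFourSquares n@(suc _) = subst (λ m → FourSquares (+ m)) (sym isFactorisation) (fourSquares-productOfPrimes factorsPrime)
  where open PrimeFactorisation (factorise n)

-- Realising a prescribed sum and sum of squares

Sᶻ : ℕ → ℤ → ℤ → Set
Sᶻ m N T = Σ (Vector ℤ m) λ x → sumℤ x ≡ T × sumSqℤ x ≡ N

Sᶻ-cons : ∀ {m N T} a → Sᶻ m N T → Sᶻ (suc m) (a * a + N) (a + T)
Sᶻ-cons a (x , refl , refl) = a ∷ x , refl , refl

Sᶻ-resp : ∀ {m N N′ T T′} → N ≡ N′ → T ≡ T′ → Sᶻ m N T → Sᶻ m N′ T′
Sᶻ-resp refl refl r = r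

Sᶻ-++ : ∀ {m m′ N N′ T T′} → Sᶻ m N T → Sᶻ m′ N′ T′ → Sᶻ (m ℕ.+ m′) (N + N′) (T + T′)
Sᶻ-++ {zero} ([] , refl , refl) r = Sᶻ-resp (sym (ℤ.+-identityˡ _)) (sym (ℤ.+-identityˡ _)) r
Sᶻ-++ {suc m} (x , refl , refl) r =
  Sᶻ-resp (sym (ℤ.+-assoc (head x * head x) _ _)) (sym (ℤ.+-assoc (head x) _ _))
    (Sᶻ-cons (head x) (Sᶻ-++ (tail x , refl , refl) r))

Sᶻ-zeroOne : ∀ k r → r ℕ.≤ k → Sᶻ k (+ r) (+ r)
Sᶻ-zeroOne zero    zero    _         = [] , refl , refl
Sᶻ-zeroOne (suc k) zero    _         = Sᶻ-cons 0ℤ (Sᶻ-zeroOne k zero ℕ.z≤n)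
Sᶻ-zeroOne (suc k) (suc r) (ℕ.s≤s r≤k) = Sᶻ-cons 1ℤ (Sᶻ-zeroOne k r r≤k)

-- The pairs uᵢ ± aᵢ keep the sum 2 Σ uᵢ and add 2 Σ aᵢ² to the sum of squares.
Sᶻ-pairs : ∀ {N T M} → Sᶻ 4 N T → FourSquares M → Sᶻ 8 (N + N + (M + M)) (T + T)
Sᶻ-pairs (u , refl , refl) (fourSquares a b c d refl) =
  (u₀ + a) ∷ (u₀ - a) ∷ (u₁ + b) ∷ (u₁ - b) ∷ (u₂ + c) ∷ (u₂ - c) ∷ (u₃ + d) ∷ (u₃ - d) ∷ [] ,
  sum≡ u₀ u₁ u₂ u₃ a b c d , sumSq≡ u₀ u₁ u₂ u₃ a b c d
  where
  u₀ = u Fin.zero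
  u₁ = u (Fin.suc Fin.zero)
  u₂ = u (Fin.suc (Fin.suc Fin.zero))
  u₃ = u (Fin.suc (Fin.suc (Fin.suc Fin.zero)))
  sum≡ : ∀ u₀ u₁ u₂ u₃ a b c d →
    (u₀ + a) + ((u₀ - a) + ((u₁ + b) + ((u₁ - b) + ((u₂ + c) + ((u₂ - c) + ((u₃ + d) + ((u₃ - d) + 0ℤ)))))))
    ≡ (u₀ + (u₁ + (u₂ + (u₃ + 0ℤ)))) + (u₀ + (u₁ + (u₂ + (u₃ + 0ℤ))))
  sum≡ = solve-∀
  sumSq≡ : ∀ u₀ u₁ u₂ u₃ a b c d →
    (u₀ + a) * (u₀ + a) + ((u₀ - a) * (u₀ - a) + ((u₁ + b) * (u₁ + b) + ((u₁ - b) * (u₁ - b) +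
    ((u₂ + c) * (u₂ + c) + ((u₂ - c) * (u₂ - c) + ((u₃ + d) * (u₃ + d) + ((u₃ - d) * (u₃ - d) + 0ℤ)))))))
    ≡ (u₀ * u₀ + (u₁ * u₁ + (u₂ * u₂ + (u₃ * u₃ + 0ℤ)))) + (u₀ * u₀ + (u₁ * u₁ + (u₂ * u₂ + (u₃ * u₃ + 0ℤ))))
      + ((a * a + b * b + c * c + d * d) + (a * a + b * b + c * c + d * d))
  sumSq≡ = solve-∀

Sᶻ-realise : ∀ k j r s → j ℕ.≤ 4 → r ℕ.≤ k → Sᶻ (8 ℕ.+ k) (+ (j ℕ.+ j ℕ.+ r) + (+ s + + s)) (+ (j ℕ.+ j ℕ.+ r))
Sᶻ-realise k j r s j≤4 r≤k = Sᶻ-resp (lem (+ j) (+ r) (+ s)) refl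
  (Sᶻ-++ (Sᶻ-pairs (Sᶻ-zeroOne 4 j j≤4) (lagrangeFourSquares s)) (Sᶻ-zeroOne k r r≤k))
  where lem : ∀ j r s → j + j + (s + s) + r ≡ j + j + r + (s + s)
        lem = solve-∀

sumℤ-shift : ∀ {m} c (z : Vector ℤ m) → sumℤ (λ i → c + z i) ≡ + m * c + sumℤ z
sumℤ-shift {zero} c z = refl
sumℤ-shift {suc m} c z = trans (cong (λ s → c + head z + s) (sumℤ-shift c (tail z))) (lem c (head z) (+ m) (sumℤ (tail z)))
  where lem : ∀ c z₀ m s → c + z₀ + (m * c + s) ≡ (1ℤ + m) * c + (z₀ + s)
        lem = solve-∀

sumSqℤ-shift : ∀ {m} c (z : Vector ℤ m) → sumSqℤ (λ i → c + z i) ≡ + m * (c * c) + (c + c) * sumℤ z + sumSqℤ z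
sumSqℤ-shift {zero} c z = lem c
  where lem : ∀ c → 0ℤ ≡ 0ℤ * (c * c) + (c + c) * 0ℤ + 0ℤ
        lem = solve-∀
sumSqℤ-shift {suc m} c z =
  trans (cong (λ q → (c + head z) * (c + head z) + q) (sumSqℤ-shift c (tail z))) (lem c (head z) (+ m) (sumℤ (tail z)) (sumSqℤ (tail z)))
  where lem : ∀ c z₀ m s q → (c + z₀) * (c + z₀) + (m * (c * c) + (c + c) * s + q) ≡ (1ℤ + m) * (c * c) + (c + c) * (z₀ + s) + (z₀ * z₀ + q)
        lem = solve-∀

Sᶻ-shift : ∀ {m N T} c → Sᶻ m N T → Sᶻ m (+ m * (c * c) + (c + c) * T + N) (+ m * c + T)
Sᶻ-shift c (z , refl , refl) = (λ i → c + z i) , sumℤ-shift c z , sumSqℤ-shift c z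

even-sumSq-sum : ∀ {m} (x : Vector ℤ m) → Even (sumSqℤ x - sumℤ x)
even-sumSq-sum {zero} x = even-double 0ℤ
even-sumSq-sum {suc m} x = subst Even (lem (head x) (sumSqℤ (tail x)) (sumℤ (tail x)))
  (ℤ∣.∣m∣n⇒∣m+n (even-square-minus-self (head x)) (even-sumSq-sum (tail x)))
  where lem : ∀ a q s → (a * a - a) + (q - s) ≡ (a * a + q) - (a + s)
        lem = solve-∀

reduceModulo : ∀ m .{{_ : ℕ.NonZero m}} n T → Even (+ n - T) →
  ∃ λ t → ∃ λ N → t ℕ.< m × Even (N - + t) × + m * N - + t * + t ≡ + m * + n - T * T × (Sᶻ m N (+ t) → S m n T)
reduceModulo m n T n-T-even = t , N , ℤ.n%ℕd<d T m , N-t-even , defect≡ , lift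
  where
  M = + m
  t = T ℤ.%ℕ m
  c = T ℤ./ℕ m
  T≡ : T ≡ + t + c * M
  T≡ = ℤ.a≡a%ℕn+[a/ℕn]*n T m
  N = + n - (M * (c * c) + (c + c) * + t)
  defect≡ : M * N - + t * + t ≡ M * + n - T * T
  defect≡ = trans (lem (+ n) (+ t) c M) (cong (λ z → M * + n - z * z) (sym T≡))
    where lem : ∀ n t c M → M * (n - (M * (c * c) + (c + c) * t)) - t * t ≡ M * n - (t + c * M) * (t + c * M)
          lem = solve-∀
  N-t-even : Even (N - + t)
  N-t-even = subst Even (trans (cong (λ z → (+ n - z) - (M * (c * c - c) + (c * + t + c * + t))) T≡) (lem (+ n) (+ t) c M))
    (ℤ∣.∣m∣n⇒∣m-n n-T-even (ℤ∣.∣m∣n⇒∣m+n (ℤ∣.∣n⇒∣m*n M (even-square-minus-self c)) (even-double (c * + t))))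
    where lem : ∀ n t c M → (n - (t + c * M)) - (M * (c * c - c) + (c * t + c * t)) ≡ (n - (M * (c * c) + (c + c) * t)) - t
          lem = solve-∀
  lift : Sᶻ m N (+ t) → S m n T
  lift r = Sᶻ-resp (lem₁ (+ n) (+ t) c M) (trans (lem₂ M c (+ t)) (sym T≡)) (Sᶻ-shift c r)
    where
    lem₁ : ∀ n t c M → M * (c * c) + (c + c) * t + (n - (M * (c * c) + (c + c) * t)) ≡ n
    lem₁ = solve-∀
    lem₂ : ∀ M c t → M * c + t ≡ t + c * M
    lem₂ = solve-∀

-- The defects m N − t² of the pairs (t, N) that the residue step can leave unrealised.
Exceptional : ℕ → ℤ → Set
Exceptional m D = ∃ λ N → ∃ λ t → N ℕ.< t × t ℕ.< m × Even (+ N - + t) × + t * + t < + m * + N × + m * + N - + t * + t ≡ D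

m+m<8⇒m≤4 : ∀ {h} → h ℕ.+ h ℕ.< 8 → h ℕ.≤ 4
m+m<8⇒m≤4 {h} h+h<8 with h ≤? 4
... | yes h≤4 = h≤4
... | no h≰4 = ⊥-elim (ℕ.<⇒≱ h+h<8 (ℕ.≤-trans (ℕ.m≤m+n 8 2) (ℕ.+-mono-≤ (ℕ.≰⇒> h≰4) (ℕ.≰⇒> h≰4))))

-- t = 2j + r: j of the four pairs are centred at 1, and r further coordinates equal 1.
residueSplitting : ∀ k t → t ℕ.< 9 ℕ.+ k → ∃ λ j → ∃ λ r → j ℕ.≤ 4 × r ℕ.≤ suc k × t ≡ j ℕ.+ j ℕ.+ r
residueSplitting k t t<m with 8 ≤? t
... | yes 8≤t = 4 , t ℕ.∸ 8 , ℕ.≤-refl , ℕ.<⇒≤ (ℕ.∸-monoˡ-< t<m 8≤t) , sym (ℕ.m+[n∸m]≡n 8≤t)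
... | no 8≰t with halve t
...   | h , inj₁ refl = h , 0 , m+m<8⇒m≤4 (ℕ.≰⇒> 8≰t) , ℕ.z≤n , sym (ℕ.+-identityʳ (h ℕ.+ h))
...   | h , inj₂ refl = h , 1 , m+m<8⇒m≤4 (ℕ.<-trans (ℕ.n<1+n (h ℕ.+ h)) (ℕ.≰⇒> 8≰t)) , ℕ.s≤s ℕ.z≤n , ℕ.+-comm 1 (h ℕ.+ h)

i<j⇒0<j-i : ∀ {i j} → i < j → 0ℤ < j - i
i<j⇒0<j-i {i} {j} i<j = subst (_< j - i) (ℤ.+-inverseʳ i) (ℤ.+-monoˡ-< (- i) i<j)

0<j-i⇒i<j : ∀ {i j} → 0ℤ < j - i → i < j
0<j-i⇒i<j {i} {j} 0<j-i = subst₂ _<_ (ℤ.+-identityˡ i) (lem j i) (ℤ.+-monoˡ-< i 0<j-i)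
  where lem : ∀ j i → j - i + i ≡ j
        lem = solve-∀

even-excess : ∀ {N t} → t ℕ.≤ N → Even (+ N - + t) → ∃ λ s → + N ≡ + t + (+ s + + s)
even-excess {N} {t} t≤N N-t-even with even-half N-t-even
... | + s , N-t≡ = s , trans (lem (+ N) (+ t)) (cong (λ x → + t + x) N-t≡)
  where lem : ∀ N t → N ≡ t + (N - t)
        lem = solve-∀
... | -[1+ s ] , N-t≡ with () ← trans (sym (trans (ℤ.m-n≡m⊖n N t) (ℤ.⊖-≥ t≤N))) N-t≡

S⊎exceptional : ∀ k n T → Even (+ n - T) → T * T < + ((9 ℕ.+ k) ℕ.* n) →
  S (9 ℕ.+ k) n T ⊎ Exceptional (9 ℕ.+ k) (+ (9 ℕ.+ k) * + n - T * T)
S⊎exceptional k n T n-T-even T²<mn =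
  let (t , N , t<m , N-t-even , defect≡ , lift) = reduceModulo m n T n-T-even
  in residueCases t N t<m N-t-even defect≡ lift
  where
  m = 9 ℕ.+ k
  0<defect : 0ℤ < + m * + n - T * T
  0<defect = i<j⇒0<j-i (subst (T * T <_) (ℤ.pos-* m n) T²<mn)
  residueCases : ∀ t N → t ℕ.< m → Even (N - + t) → + m * N - + t * + t ≡ + m * + n - T * T → (Sᶻ m N (+ t) → S m n T) →
                 S m n T ⊎ Exceptional m (+ m * + n - T * T)
  residueCases t -[1+ N ] _ _ defect≡ _ =
    ⊥-elim (negative (t ℕ.* t) (subst (0ℤ <_) (trans (sym defect≡) (cong (λ x → + m * -[1+ N ] - x) (sym (ℤ.pos-* t t)))) 0<defect))
    where
    negative : ∀ {z} w → ¬ 0ℤ < -[1+ z ] - + w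
    negative zero ()
    negative (suc w) ()
  residueCases t (+ N) t<m N-t-even defect≡ lift with N ℕ.<? t
  ... | yes N<t = inj₂ (N , t , N<t , t<m , N-t-even , 0<j-i⇒i<j (subst (0ℤ <_) (sym defect≡) 0<defect) , defect≡)
  ... | no N≮t =
    let (s , N≡) = even-excess (ℕ.≮⇒≥ N≮t) N-t-even
        (j , r , j≤4 , r≤k , t≡) = residueSplitting k t t<m
    in inj₁ (lift (Sᶻ-resp (sym (trans N≡ (cong (λ u → + u + (+ s + + s)) t≡))) (cong +_ (sym t≡)) (Sᶻ-realise (suc k) j r s j≤4 r≤k)))

sumℤ-const : ∀ {m} (x : Vector ℤ m) c → (∀ i → x i ≡ c) → sumℤ x ≡ + m * c
sumℤ-const {zero} x c _ = refl
sumℤ-const {suc m} x c x≡c = trans (cong₂ _+_ (x≡c Fin.zero) (sumℤ-const (tail x) c (λ i → x≡c (Fin.suc i)))) (lem c (+ m))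
  where lem : ∀ c m → c + m * c ≡ (1ℤ + m) * c
        lem = solve-∀

-- The defect

sumSqℤ-nonNeg : ∀ {m} (x : Vector ℤ m) → ∃ λ g → sumSqℤ x ≡ + g
sumSqℤ-nonNeg {zero} x = 0 , refl
sumSqℤ-nonNeg {suc m} x =
  let (g , Σ≡g) = sumSqℤ-nonNeg (tail x)
  in ∣ head x ∣ ℕ.* ∣ head x ∣ ℕ.+ g , trans (cong₂ _+_ (square-abs (head x)) Σ≡g) (sym (ℤ.pos-+ _ g))

sumSqℤ≡0 : ∀ {m} (x : Vector ℤ m) → sumSqℤ x ≡ 0ℤ → ∀ i → x i ≡ 0ℤ
sumSqℤ≡0 {suc m} x Σ≡0 i with sumSqℤ-nonNeg (tail x)
... | g , Σtail≡g with ℤ.+-injective (trans (sym (ℤ.pos-+ (∣ head x ∣ ℕ.* ∣ head x ∣) g))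
                       (trans (sym (cong₂ _+_ (square-abs (head x)) Σtail≡g)) Σ≡0))
...   | a²+g≡0 with i
...     | Fin.zero = ℤ.∣i∣≡0⇒i≡0 (square≡0 (ℕ.m+n≡0⇒m≡0 _ a²+g≡0))
...     | Fin.suc j = sumSqℤ≡0 (tail x) (trans Σtail≡g (cong +_ (ℕ.m+n≡0⇒n≡0 (∣ head x ∣ ℕ.* ∣ head x ∣) a²+g≡0))) j

-- Equals Σ_{i<j} (xᵢ − xⱼ)².
defect : ∀ {m} → Vector ℤ m → ℤ
defect {m} x = + m * sumSqℤ x - sumℤ x * sumℤ x

defect-const : ∀ {m} (x : Vector ℤ m) c → (∀ i → x i ≡ c) → defect x ≡ 0ℤ
defect-const {m} x c x≡c =
  trans (cong₂ (λ q s → + m * q - s * s) (sumℤ-const (λ i → x i * x i) (c * c) (λ i → cong₂ _*_ (x≡c i) (x≡c i))) (sumℤ-const x c x≡c))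
        (lem (+ m) c)
  where lem : ∀ m c → m * (m * (c * c)) - (m * c) * (m * c) ≡ 0ℤ
        lem = solve-∀

defect-cons : ∀ {m} a (x : Vector ℤ m) → defect (a ∷ x) ≡ defect x + sumSqℤ (λ i → - a + x i)
defect-cons {m} a x = trans (lem a (+ m) (sumℤ x) (sumSqℤ x)) (cong (λ q → defect x + q) (sym (sumSqℤ-shift (- a) x)))
  where lem : ∀ a m s q → (1ℤ + m) * (a * a + q) - (a + s) * (a + s) ≡ (m * q - s * s) + (m * ((- a) * (- a)) + ((- a) + (- a)) * s + q)
        lem = solve-∀

square-nonZero : ∀ x → x ≢ 0ℤ → ∃ λ w → x * x ≡ + suc w
square-nonZero (+ zero) x≢0 = ⊥-elim (x≢0 refl)
square-nonZero (+ suc n) _ = _ , refl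
square-nonZero -[1+ n ]  _ = _ , refl

-i+j≡0⇒j≡i : ∀ i j → - i + j ≡ 0ℤ → j ≡ i
-i+j≡0⇒j≡i i j -i+j≡0 = ℤ.i-j≡0⇒i≡j j i (trans (ℤ.+-comm j (- i)) -i+j≡0)

defect-gap : ∀ {m} (x : Vector ℤ (suc m)) → (∃ λ c → ∀ i → x i ≡ c) ⊎ (∃ λ f → defect x ≡ + (m ℕ.+ f))
defect-gap {zero} x = inj₁ (head x , λ { Fin.zero → refl })
defect-gap {suc m} y with defect-gap (tail y)
... | inj₁ (c , tail≡c) with c ℤ.≟ head y
...   | yes c≡a = inj₁ (head y , λ { Fin.zero → refl ; (Fin.suc i) → trans (tail≡c i) c≡a })
...   | no c≢a =
  let (w , [c-a]²≡) = square-nonZero (- head y + c) (λ -a+c≡0 → c≢a (-i+j≡0⇒j≡i (head y) c -a+c≡0))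
  in inj₂ (suc m ℕ.* w , (begin
    defect y                                                ≡⟨ defect-cons (head y) (tail y) ⟩
    defect (tail y) + sumSqℤ (λ i → - head y + tail y i)     ≡⟨ cong₂ _+_ (defect-const (tail y) c tail≡c)
                                                                  (sumℤ-const _ ((- head y + c) * (- head y + c)) (λ i → cong (λ z → (- head y + z) * (- head y + z)) (tail≡c i))) ⟩
    0ℤ + + suc m * ((- head y + c) * (- head y + c))          ≡⟨ ℤ.+-identityˡ _ ⟩
    + suc m * ((- head y + c) * (- head y + c))               ≡⟨ cong (+ suc m *_) [c-a]²≡ ⟩
    + suc m * + suc w                                       ≡⟨ ℤ.pos-* (suc m) (suc w) ⟨
    + (suc m ℕ.* suc w)                                     ≡⟨ cong +_ (ℕ.*-suc (suc m) w) ⟩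
    + (suc m ℕ.+ suc m ℕ.* w)                                ∎))
  where open ≡-Reasoning
defect-gap {suc m} y | inj₂ (f , defect≡) with sumSqℤ-nonNeg (λ i → - head y + tail y i)
... | zero , Σ≡0 = inj₁ (head y , λ { Fin.zero → refl ; (Fin.suc i) → -i+j≡0⇒j≡i (head y) (tail y i) (sumSqℤ≡0 (λ i → - head y + tail y i) Σ≡0 i) })
... | suc g , Σ≡g = inj₂ (f ℕ.+ g , (begin
    defect y                                              ≡⟨ defect-cons (head y) (tail y) ⟩
    defect (tail y) + sumSqℤ (λ i → - head y + tail y i)   ≡⟨ cong₂ _+_ defect≡ Σ≡g ⟩
    + (m ℕ.+ f) + + suc g                                 ≡⟨ ℤ.pos-+ (m ℕ.+ f) (suc g) ⟨
    + (m ℕ.+ f ℕ.+ suc g)                                 ≡⟨ cong +_ (trans (ℕ.+-suc (m ℕ.+ f) g) (cong suc (ℕ.+-assoc m f g))) ⟩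
    + (suc m ℕ.+ (f ℕ.+ g))                               ∎))
  where open ≡-Reasoning

¬S-smallDefect : ∀ {m n T e} → 0 ℕ.< e → e ℕ.< m → + suc m * + n - T * T ≡ + e → ¬ S (suc m) n T
¬S-smallDefect {m} {n} {T} {e} 0<e e<m defect≡e (x , Σx≡T , Σx²≡n) = [ constant , large ]′ (defect-gap x)
  where
  defect-x≡e : defect x ≡ + e
  defect-x≡e = trans (cong₂ (λ q s → + suc m * q - s * s) Σx²≡n Σx≡T) defect≡e
  constant : ¬ ∃ λ c → ∀ i → x i ≡ c
  constant (c , x≡c) = ℕ.<⇒≢ 0<e (ℤ.+-injective (trans (sym (defect-const x c x≡c)) defect-x≡e))
  large : ¬ ∃ λ f → defect x ≡ + (m ℕ.+ f)
  large (f , defect≡) = ℕ.<⇒≱ e<m (subst (m ℕ.≤_) (ℤ.+-injective (trans (sym defect≡) defect-x≡e)) (ℕ.m≤m+n m f))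

even-sub⇔even-square-sub : ∀ x T → Even (x - T) ⇔ Even (T * T - x)
even-sub⇔even-square-sub x T = mk⇔
  (λ x-T-even → subst Even (lem₁ x T) (ℤ∣.∣m∣n⇒∣m-n (even-square-minus-self T) x-T-even))
  (λ T²-x-even → subst Even (lem₂ x T) (ℤ∣.∣m∣n⇒∣m-n (even-square-minus-self T) T²-x-even))
  where
  lem₁ : ∀ x T → (T * T - T) - (x - T) ≡ T * T - x
  lem₁ = solve-∀
  lem₂ : ∀ x T → (T * T - T) - (T * T - x) ≡ x - T
  lem₂ = solve-∀

S'⇒Tset : ∀ {m n T} → S' m n T → Tset m n T
S'⇒Tset ((x , Σx≡T , Σx²≡n) , T²<mn) = ℤ∣.∣⇒∣ᵤ (subst₂ (λ q s → Even (q - s)) Σx²≡n Σx≡T (even-sumSq-sum x)) , T²<mn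

full-ifNotExceptional : ∀ k n → (∀ T → Even (+ n - T) → ¬ Exceptional (9 ℕ.+ k) (+ (9 ℕ.+ k) * + n - T * T)) → Full (9 ℕ.+ k) n
full-ifNotExceptional k n notExceptional T = mk⇔ S'⇒Tset realise
  where
  realise : Tset (9 ℕ.+ k) n T → S' (9 ℕ.+ k) n T
  realise (n-T-even , T²<mn) =
    [ (_, T²<mn) , (λ exc → ⊥-elim (notExceptional T (ℤ∣.∣ᵤ⇒∣ n-T-even) exc)) ]′ (S⊎exceptional k n T (ℤ∣.∣ᵤ⇒∣ n-T-even) T²<mn)

full⇒¬square : ∀ {m n e} → Full (suc m) n → 0 ℕ.< e → e ℕ.< m → Even (+ suc m * + n - + e - + n) → ¬ IsSquare (+ (suc m ℕ.* n) - + e)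
full⇒¬square {m} {n} {suc e} full 0<e e<m even (T , T²≡) =
  ¬S-smallDefect 0<e e<m defect≡e (proj₁ (Equivalence.from (full T) (ℤ∣.∣⇒∣ᵤ n-T-even , T²<mn)))
  where
  n-T-even : Even (+ n - T)
  n-T-even = Equivalence.from (even-sub⇔even-square-sub (+ n) T)
    (subst (λ z → Even (z - + n)) (trans (cong (_- + suc e) (sym (ℤ.pos-* (suc m) n))) (sym T²≡)) even)
  T²<mn : T * T < + (suc m ℕ.* n)
  T²<mn = subst (_< + (suc m ℕ.* n)) (sym T²≡) (0<j-i⇒i<j (subst (0ℤ <_) (lem (+ (suc m ℕ.* n)) (+ suc e)) (ℤ.+<+ ℕ.z<s)))
    where lem : ∀ x e → e ≡ x - (x - e)
          lem = solve-∀
  defect≡e : + suc m * + n - T * T ≡ + suc e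
  defect≡e = trans (cong₂ _-_ (sym (ℤ.pos-* (suc m) n)) T²≡) (lem (+ (suc m ℕ.* n)) (+ suc e))
    where lem : ∀ x e → x - (x - e) ≡ e
          lem = solve-∀

defect-parity : ∀ {m n e} T → + m * + n - T * T ≡ + e → Even (+ n - T) → Even (+ m * + n - + e - + n)
defect-parity {m} {n} {e} T defect≡e n-T-even =
  subst (λ z → Even (z - + n)) (trans (lem (+ m * + n) (T * T)) (cong (λ z → + m * + n - z) defect≡e))
    (Equivalence.to (even-sub⇔even-square-sub (+ n) T) n-T-even)
  where lem : ∀ x y → y ≡ x - (x - y)
        lem = solve-∀

defect≡⇒square : ∀ {m n e} T → + m * + n - T * T ≡ + e → IsSquare (+ (m ℕ.* n) - + e)
defect≡⇒square {m} {n} {e} T defect≡ = T , trans (lem (+ m * + n) (T * T)) (cong₂ _-_ (sym (ℤ.pos-* m n)) defect≡)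
  where lem : ∀ x y → y ≡ x - (x - y)
        lem = solve-∀

ExceptionalCase : ℕ → (ℤ → Set) → ℕ → ℕ → Set
ExceptionalCase m P N t = N ℕ.< t → Even (+ N - + t) → + t * + t < + m * + N → P (+ m * + N - + t * + t)

exceptionalCase? : ∀ m {P : ℤ → Set} → (∀ D → Dec (P D)) → ∀ N t → Dec (ExceptionalCase m P N t)
exceptionalCase? m P? N t = N ℕ.<? t →-dec (+ 2 ℤ∣.∣? (+ N - + t)) →-dec (+ t * + t ℤ.<? + m * + N) →-dec P? _

exceptional-byCases : ∀ {m P D} → (∀ (N t : Fin m) → ExceptionalCase m P (toℕ N) (toℕ t)) → Exceptional m D → P D
exceptional-byCases {m} {P} cases (N , t , N<t , t<m , even , t²<mN , refl) =
  subst₂ (ExceptionalCase m P) (Fin.toℕ-fromℕ< N<m) (Fin.toℕ-fromℕ< t<m) (cases (fromℕ< N<m) (fromℕ< t<m)) N<t even t²<mN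
  where N<m = ℕ.<-trans N<t t<m

exceptional-9 : ∀ {D} → Exceptional 9 D → D ≡ + 2
exceptional-9 = exceptional-byCases (toWitness {a? = Fin.all? λ N → Fin.all? λ t → exceptionalCase? 9 (ℤ._≟ + 2) (toℕ N) (toℕ t)} _)

exceptional-10 : ∀ {D} → Exceptional 10 D → D ≡ + 1 ⊎ D ≡ + 4 ⊎ D ≡ + 5
exceptional-10 = exceptional-byCases (toWitness {a? = Fin.all? λ N → Fin.all? λ t →
  exceptionalCase? 10 (λ D → D ℤ.≟ + 1 ⊎-dec D ℤ.≟ + 4 ⊎-dec D ℤ.≟ + 5) (toℕ N) (toℕ t)} _)

exceptional-11 : ∀ {D} → Exceptional 11 D → D ≡ + 2 ⊎ D ≡ + 6 ⊎ D ≡ + 8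
exceptional-11 = exceptional-byCases (toWitness {a? = Fin.all? λ N → Fin.all? λ t →
  exceptionalCase? 11 (λ D → D ℤ.≟ + 2 ⊎-dec D ℤ.≟ + 6 ⊎-dec D ℤ.≟ + 8) (toℕ N) (toℕ t)} _)

even-by : ∀ {x} q → x ≡ q + q → Even x
even-by q refl = even-double q

¬even-by : ∀ {x} q → x ≡ q + q + 1ℤ → ¬ Even x
¬even-by q refl = ¬even-and-odd (even-double q)

¬2∣1+h+h : ∀ h → ¬ 2 ∣ suc (h ℕ.+ h)
¬2∣1+h+h h (divides q eq) = ℕ.even≢odd q h (trans (ℕ.*-comm 2 q) (trans (sym eq) (cong (λ z → suc (h ℕ.+ z)) (sym (ℕ.+-identityʳ h)))))

full-9 : ∀ n → Full 9 n ⇔ (¬ IsSquare (+ (9 ℕ.* n) - + 2))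
full-9 n = mk⇔
  (λ full → full⇒¬square full ℕ.z<s (ℕ.m<m+n 2 ℕ.z<s) (even-by (+ 4 * + n - 1ℤ) (lem (+ n))))
  (λ ¬square → full-ifNotExceptional 0 n λ T _ exc → ¬square (defect≡⇒square {9} {n} T (exceptional-9 exc)))
  where lem : ∀ n → + 9 * n - + 2 - n ≡ (+ 4 * n - 1ℤ) + (+ 4 * n - 1ℤ)
        lem = solve-∀

full-11 : ∀ n → Full 11 n ⇔ (¬ IsSquare (+ (11 ℕ.* n) - + 2) × ¬ IsSquare (+ (11 ℕ.* n) - + 6) × ¬ IsSquare (+ (11 ℕ.* n) - + 8))
full-11 n = mk⇔
  (λ full → full⇒¬square full ℕ.z<s (ℕ.m<m+n 2 ℕ.z<s) (even-by (+ 5 * + n - + 1) (lem₂ (+ n))) ,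
            full⇒¬square full ℕ.z<s (ℕ.m<m+n 6 ℕ.z<s) (even-by (+ 5 * + n - + 3) (lem₆ (+ n))) ,
            full⇒¬square full ℕ.z<s (ℕ.m<m+n 8 ℕ.z<s) (even-by (+ 5 * + n - + 4) (lem₈ (+ n))))
  (λ (¬square₂ , ¬square₆ , ¬square₈) → full-ifNotExceptional 2 n λ T _ exc →
    [ ¬square₂ ∘ square T , [ ¬square₆ ∘ square T , ¬square₈ ∘ square T ]′ ]′ (exceptional-11 exc))
  where
  square : ∀ {e} T → + 11 * + n - T * T ≡ + e → IsSquare (+ (11 ℕ.* n) - + e)
  square = defect≡⇒square {11} {n}
  lem₂ : ∀ n → + 11 * n - + 2 - n ≡ (+ 5 * n - + 1) + (+ 5 * n - + 1)
  lem₂ = solve-∀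
  lem₆ : ∀ n → + 11 * n - + 6 - n ≡ (+ 5 * n - + 3) + (+ 5 * n - + 3)
  lem₆ = solve-∀
  lem₈ : ∀ n → + 11 * n - + 8 - n ≡ (+ 5 * n - + 4) + (+ 5 * n - + 4)
  lem₈ = solve-∀

-- T ≡ n forces T² ≡ n, so a defect e can only occur when 10 n − e ≡ n (mod 2):
-- this excludes 1 and 5 for even n, and 4 for odd n.
full-10 : ∀ n → Full 10 n ⇔ ((¬ (2 ∣ n) × ¬ IsSquare (+ (10 ℕ.* n) - + 1) × ¬ IsSquare (+ (10 ℕ.* n) - + 5))
                            ⊎ ((2 ∣ n) × ¬ IsSquare (+ (10 ℕ.* n) - + 4)))
full-10 n with halve n
... | h , inj₁ refl = mk⇔
  (λ full → inj₂ (2∣h+h h , full⇒¬square full ℕ.z<s (ℕ.m<m+n 4 ℕ.z<s) (even-by (+ 9 * + h - + 2) (lem₄ (+ h)))))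
  [ (λ (2∤n , _) → ⊥-elim (2∤n (2∣h+h h)))
  , (λ (_ , ¬square₄) → full-ifNotExceptional 1 n λ T n-T-even exc →
       [ (λ defect≡1 → ¬even-by (+ 9 * + h - 1ℤ) (lem₁ (+ h)) (defect-parity {10} {n} T defect≡1 n-T-even))
       , [ ¬square₄ ∘ defect≡⇒square {10} {n} T
         , (λ defect≡5 → ¬even-by (+ 9 * + h - + 3) (lem₅ (+ h)) (defect-parity {10} {n} T defect≡5 n-T-even)) ]′ ]′ (exceptional-10 exc)) ]′
  where
  lem₄ : ∀ h → + 10 * (h + h) - + 4 - (h + h) ≡ (+ 9 * h - + 2) + (+ 9 * h - + 2)
  lem₄ = solve-∀
  lem₁ : ∀ h → + 10 * (h + h) - + 1 - (h + h) ≡ (+ 9 * h - 1ℤ) + (+ 9 * h - 1ℤ) + 1ℤ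
  lem₁ = solve-∀
  lem₅ : ∀ h → + 10 * (h + h) - + 5 - (h + h) ≡ (+ 9 * h - + 3) + (+ 9 * h - + 3) + 1ℤ
  lem₅ = solve-∀
... | h , inj₂ refl = mk⇔
  (λ full → inj₁ (¬2∣1+h+h h ,
    full⇒¬square full ℕ.z<s (ℕ.m<m+n 1 ℕ.z<s) (even-by (+ 9 * + h + + 4) (lem₁ (+ h))) ,
    full⇒¬square full ℕ.z<s (ℕ.m<m+n 5 ℕ.z<s) (even-by (+ 9 * + h + + 2) (lem₅ (+ h)))))
  [ (λ (_ , ¬square₁ , ¬square₅) → full-ifNotExceptional 1 n λ T n-T-even exc →
       [ ¬square₁ ∘ defect≡⇒square {10} {n} T
       , [ (λ defect≡4 → ¬even-by (+ 9 * + h + + 2) (lem₄ (+ h)) (defect-parity {10} {n} T defect≡4 n-T-even))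
         , ¬square₅ ∘ defect≡⇒square {10} {n} T ]′ ]′ (exceptional-10 exc))
  , (λ (2∣n , _) → ⊥-elim (¬2∣1+h+h h 2∣n)) ]′
  where
  lem₁ : ∀ h → + 10 * (1ℤ + (h + h)) - + 1 - (1ℤ + (h + h)) ≡ (+ 9 * h + + 4) + (+ 9 * h + + 4)
  lem₁ = solve-∀
  lem₅ : ∀ h → + 10 * (1ℤ + (h + h)) - + 5 - (1ℤ + (h + h)) ≡ (+ 9 * h + + 2) + (+ 9 * h + + 2)
  lem₅ = solve-∀
  lem₄ : ∀ h → + 10 * (1ℤ + (h + h)) - + 4 - (1ℤ + (h + h)) ≡ (+ 9 * h + + 2) + (+ 9 * h + + 2) + 1ℤ
  lem₄ = solve-∀

corollary4p8 : ∀ (n : ℕ) →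
    (n > 9 → (Full 9 n ⇔ (¬ IsSquare (+ (9 ℕ.* n) - + 2)))) ×
    (n > 10 → (Full 10 n ⇔
        ((¬ (2 ∣ n) × ¬ IsSquare (+ (10 ℕ.* n) - + 1) × ¬ IsSquare (+ (10 ℕ.* n) - + 5))
         ⊎ ((2 ∣ n) × ¬ IsSquare (+ (10 ℕ.* n) - + 4))))) ×
    (n > 11 → (Full 11 n ⇔
        (¬ IsSquare (+ (11 ℕ.* n) - + 2) × ¬ IsSquare (+ (11 ℕ.* n) - + 6)
         × ¬ IsSquare (+ (11 ℕ.* n) - + 8))))
corollary4p8 n = (λ _ → full-9 n) , (λ _ → full-10 n) , (λ _ → full-11 n)
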